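{- Let $G$ be a distance critical graph on $n \ge 1$ vertices and let $S$ be the set of vertices of $G$ that are involved in some determining pair (that is, $u \in S$ iff there are vertices $w,v$ with $\{u,w\}$ a determining pair for $v$). Then $|S| > \sqrt{2n}$.
   Context: All graphs are finite, simple and undirected. For vertices $x,y$ of a graph $G$, $d_G(x,y)$ is the length of a shortest path from $x$ to $y$ in $G$ ($\infty$ if none exists). A graph $G$ is distance critical if for every vertex $v \in V(G)$ there exist vertices $x,y \in V(G)\setminus\{v\}$ with $d_G(x,y) \neq d_{G-v}(x,y)$. A pair of vertices $\{a,b\}$ is a determining pair for a vertex $v$ if $a$ and $b$ are distinct and nonadjacent and $v$ is their unique common neighbor. -}

module Defs where

open import Data.Nat using (ℕ; zero; suc; _<_)
open import Data.Fin using (Fin)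
open import Data.Bool using (Bool; true; false)
open import Data.Unit using (⊤)
open import Data.Maybe using (Maybe; just; nothing)
open import Data.Product using (_×_; ∃-syntax)
open import Relation.Nullary using (¬_)
open import Relation.Binary.PropositionalEquality using (_≡_; _≢_)

record Graph (n : ℕ) : Set where
  field
    adj   : Fin n → Fin n → Bool
    sym   : ∀ x y → adj x y ≡ adj y x
    irrefl : ∀ x → adj x x ≡ false
open Graph public

-- Walks of length k in G, all of whose vertices satisfy `ok`.
-- With ok = (λ _ → ⊤) these are walks in G; with ok = (λ u → u ≢ v)
-- these are exactly the walks in the induced subgraph G - v.
data Walk {n : ℕ} (G : Graph n) (ok : Fin n → Set) : Fin n → Fin n → ℕ → Set where
  nil  : ∀ {x} → ok x → Walk G ok x x 0
  cons : ∀ {x y z k} → ok x → adj G x y ≡ true → Walk G ok y z k → Walk G ok x z (suc k)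

-- Distance as a value in ℕ ∪ {∞} (nothing = ∞): d is the distance from x to y
-- in the (sub)graph of G induced on the vertices satisfying ok.
IsDist : ∀ {n} → Graph n → (Fin n → Set) → Fin n → Fin n → Maybe ℕ → Set
IsDist G ok x y (just k) = Walk G ok x y k × (∀ m → m < k → ¬ Walk G ok x y m)
IsDist G ok x y nothing  = ∀ m → ¬ Walk G ok x y m

All-V : ∀ {n} → Fin n → Set
All-V _ = ⊤

Minus : ∀ {n} → Fin n → Fin n → Set
Minus v u = u ≢ v

DistanceChanges : ∀ {n} → Graph n → Fin n → Fin n → Fin n → Set
DistanceChanges G v x y =
  ∃[ d ] ∃[ d' ] (IsDist G All-V x y d × IsDist G (Minus v) x y d' × d ≢ d')

DistanceCritical : ∀ {n} → Graph n → Set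
DistanceCritical {n} G =
  ∀ (v : Fin n) → ∃[ x ] ∃[ y ] (x ≢ v × y ≢ v × DistanceChanges G v x y)

DeterminingPair : ∀ {n} → Graph n → Fin n → Fin n → Fin n → Set
DeterminingPair G a b v =
  a ≢ b × adj G a b ≡ false × adj G a v ≡ true × adj G b v ≡ true ×
  (∀ w → adj G a w ≡ true → adj G b w ≡ true → w ≡ v)

InS : ∀ {n} → Graph n → Fin n → Set
InS G u = ∃[ w ] ∃[ v ] DeterminingPair G u w v

{-# OPTIONS --safe #-}
-- If deleting v changes d(x, y), every shortest x–y walk passes through v.  On
-- such a walk the neighbours a, b of v are distinct and nonadjacent (else the
-- walk could be shortened) and have v as their only common neighbour (else the
-- walk could be rerouted around v), so every vertex has a determining pair, and
-- a determining pair determines its vertex.  Hence v ↦ (a, b) and v ↦ (b, a)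
-- embed two copies of the n vertices into the off-diagonal part of S × S, so
-- 2n ≤ |S|² − |S| < |S|².
module Submission where

open import Defs hiding (sym)
open import Data.Nat using (ℕ; zero; suc; _+_; _*_; _≤_; _<_; s≤s)
open import Data.Fin.Subset using (Subset; _∈_; ∣_∣)
open import Function.Bundles using (_⇔_)
open import Data.Nat.Properties
  using (≤-antisym; ≮⇒≥; <⇒≱; n<1+n; m≤m+n; m≤n+m; +-suc; +-identityʳ; +-mono-<; +-monoˡ-<; +-monoʳ-<)
open import Data.Fin using (Fin; zero; suc; punchOut)
open import Data.Fin.Properties using (_≟_; suc-injective; punchOut-injective; injective⇒≤; +↔⊎; *↔×)
open import Data.Bool using (true; false)
open import Data.Bool.Properties using (¬-not)
open import Data.Vec using (_∷_; here; there)
open import Data.Unit using (tt)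
open import Data.Empty using (⊥-elim)
open import Data.Maybe using (just; nothing)
open import Data.Product using (_×_; _,_; proj₁; proj₂; swap; ∃-syntax)
open import Data.Product.Properties using (×-≡,≡←≡)
open import Data.Sum using (_⊎_; inj₁; inj₂; reduce)
open import Function using (_∘_; Injective; Inverse; Injection; Equivalence)
open import Function.Properties.Inverse using (↔⇒↣; ↔-sym)
open import Relation.Nullary using (¬_; yes; no)
open import Relation.Binary.PropositionalEquality
  using (_≡_; _≢_; refl; sym; trans; cong; cong₂; subst)

private variable
  n i j k m : ℕ

NoShorterWalk : Graph n → (Fin n → Set) → Fin n → Fin n → ℕ → Set
NoShorterWalk G ok x y k = ∀ m → m < k → ¬ Walk G ok x y m

module _ {n : ℕ} {G : Graph n} where

  private variable
    ok : Fin n → Set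
    x y z a b v : Fin n

  _++ʷ_ : Walk G ok x y i → Walk G ok y z j → Walk G ok x z (i + j)
  nil _        ++ʷ Q = Q
  cons o xy P ++ʷ Q = cons o xy (P ++ʷ Q)

  forget-avoidance : Walk G (Minus v) x y k → Walk G All-V x y k
  forget-avoidance (nil _)       = nil tt
  forget-avoidance (cons _ xy P) = cons tt xy (forget-avoidance P)

  snoc : Walk G ok x y k → ok z → adj G y z ≡ true → Walk G ok x z (suc k)
  snoc (nil o)       oz yz = cons o yz (nil oz)
  snoc (cons o xy P) oz yz = cons o xy (snoc P oz yz)

  unsnoc : Walk G ok x z (suc k) → ∃[ a ] (Walk G ok x a k × adj G a z ≡ true)
  unsnoc (cons o xz (nil _))       = _ , nil o , xz
  unsnoc (cons o xy P@(cons _ _ _)) with unsnoc P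
  ... | a , P′ , az = a , cons o xy P′ , az

  avoids-or-visits : ∀ v → Walk G All-V x y k →
    Walk G (Minus v) x y k ⊎
    ∃[ i ] ∃[ j ] (i + j ≡ k × Walk G All-V x v i × Walk G All-V v y j)
  avoids-or-visits v (nil {x} _) with x ≟ v
  ... | yes refl = inj₂ (0 , 0 , refl , nil tt , nil tt)
  ... | no x≢v   = inj₁ (nil x≢v)
  avoids-or-visits v (cons {x} _ xy P) with x ≟ v
  ... | yes refl = inj₂ (0 , _ , refl , nil tt , cons tt xy P)
  ... | no x≢v with avoids-or-visits v P
  ...   | inj₁ P′                    = inj₁ (cons x≢v xy P′)
  ...   | inj₂ (i , j , eq , P₁ , P₂) = inj₂ (suc i , j , cong suc eq , cons tt xy P₁ , P₂)

  NoShorterWalk-≤ : NoShorterWalk G ok x y k → Walk G ok x y m → k ≤ m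
  NoShorterWalk-≤ shortest W = ≮⇒≥ (λ m<k → shortest _ m<k W)

  IsDist-shortest : ∀ {d} → IsDist G ok x y d →
    Walk G ok x y k → NoShorterWalk G ok x y k → d ≡ just k
  IsDist-shortest {d = nothing} unreachable W _ = ⊥-elim (unreachable _ W)
  IsDist-shortest {d = just k′} (W′ , shortest′) W shortest =
    cong just (≤-antisym (NoShorterWalk-≤ shortest′ W) (NoShorterWalk-≤ shortest W′))

  -- Visiting v within the first i steps would yield an x–y walk of length ≤ i + j.
  prefix-avoids : NoShorterWalk G All-V x y (suc i + j) → Walk G All-V v y j →
    Walk G All-V x a i → Walk G (Minus v) x a i
  prefix-avoids {v = v} shortest Q P with avoids-or-visits v P
  ... | inj₁ P′ = P′
  ... | inj₂ (i₁ , j₁ , refl , P₁ , _) =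
    ⊥-elim (<⇒≱ (+-monoˡ-< _ (s≤s (m≤m+n i₁ j₁))) (NoShorterWalk-≤ shortest (P₁ ++ʷ Q)))

  suffix-avoids : NoShorterWalk G All-V x y (i + suc j) → Walk G All-V x v i →
    Walk G All-V b y j → Walk G (Minus v) b y j
  suffix-avoids {i = i} {v = v} shortest P Q with avoids-or-visits v Q
  ... | inj₁ Q′ = Q′
  ... | inj₂ (i₂ , j₂ , refl , _ , Q₂) =
    ⊥-elim (<⇒≱ (+-monoʳ-< i (s≤s (m≤n+m j₂ i₂))) (NoShorterWalk-≤ shortest (P ++ʷ Q₂)))

module _ {n : ℕ} (G : Graph n) where

  private variable
    x y a b u v : Fin n

  adj⇒≢ : adj G a b ≡ true → a ≢ b
  adj⇒≢ {a} ab refl with trans (sym (irrefl G a)) ab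
  ... | ()

  -- A common neighbour w ≢ v of a and b would reroute x…a v b…y around v.
  shortest-through⇒DeterminingPair :
    NoShorterWalk G All-V x y (suc i + suc j) → ¬ Walk G (Minus v) x y (suc i + suc j) →
    Walk G All-V x a i → adj G a v ≡ true → adj G v b ≡ true → Walk G All-V b y j →
    DeterminingPair G a b v
  shortest-through⇒DeterminingPair {i = i} {j = j} {v = v} {a = a} {b = b}
    shortest unavoidable P av vb Q = a≢b , ¬-not ¬ab , av , bv , unique
    where
    bv : adj G b v ≡ true
    bv = trans (Graph.sym G b v) vb

    a≢b : a ≢ b
    a≢b refl = <⇒≱ (+-mono-< (n<1+n i) (n<1+n j)) (NoShorterWalk-≤ shortest (P ++ʷ Q))

    ¬ab : adj G a b ≢ true
    ¬ab ab = <⇒≱ (+-monoˡ-< (suc j) (n<1+n i)) (NoShorterWalk-≤ shortest (P ++ʷ cons tt ab Q))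

    unique : ∀ w → adj G a w ≡ true → adj G b w ≡ true → w ≡ v
    unique w aw bw with w ≟ v
    ... | yes w≡v = w≡v
    ... | no w≢v  = ⊥-elim (unavoidable (subst (Walk G (Minus v) _ _) (+-suc i (suc j)) detour))
      where
      detour : Walk G (Minus v) _ _ (i + suc (suc j))
      detour = prefix-avoids shortest (cons tt vb Q) P
          ++ʷ cons (adj⇒≢ av) aw (cons w≢v (trans (Graph.sym G w b) bw)
                 (suffix-avoids shortest (snoc P tt av) Q))

  unavoidable-vertex⇒DeterminingPair : x ≢ v → y ≢ v →
    Walk G All-V x y k → NoShorterWalk G All-V x y k → ¬ Walk G (Minus v) x y k →
    ∃[ a ] ∃[ b ] DeterminingPair G a b v
  unavoidable-vertex⇒DeterminingPair {v = v} x≢v y≢v W shortest unavoidable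
    with avoids-or-visits v W
  ... | inj₁ W′                           = ⊥-elim (unavoidable W′)
  ... | inj₂ (zero , _ , _ , nil _ , _)     = ⊥-elim (x≢v refl)
  ... | inj₂ (suc _ , zero , _ , _ , nil _) = ⊥-elim (y≢v refl)
  ... | inj₂ (suc _ , suc _ , refl , P , cons _ vb Q) =
    let a , P′ , av = unsnoc P
    in a , _ , shortest-through⇒DeterminingPair shortest unavoidable P′ av vb Q

  DistanceChanges⇒unavoidable : DistanceChanges G v x y →
    ∃[ k ] (Walk G All-V x y k × NoShorterWalk G All-V x y k × ¬ Walk G (Minus v) x y k)
  DistanceChanges⇒unavoidable (nothing , nothing , _ , _ , d≢d′) = ⊥-elim (d≢d′ refl)
  DistanceChanges⇒unavoidable (nothing , just _ , unreachable , (W′ , _) , _) =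
    ⊥-elim (unreachable _ (forget-avoidance W′))
  DistanceChanges⇒unavoidable (just k , _ , (W , shortest) , dist′ , d≢d′) =
    k , W , shortest , λ W′ →
      d≢d′ (sym (IsDist-shortest dist′ W′ (λ m m<k → shortest m m<k ∘ forget-avoidance)))

  DistanceCritical⇒DeterminingPair : DistanceCritical G → ∀ v → ∃[ a ] ∃[ b ] DeterminingPair G a b v
  DistanceCritical⇒DeterminingPair critical v =
    let _ , _ , x≢v , y≢v , changes    = critical v
        _ , W , shortest , unavoidable = DistanceChanges⇒unavoidable changes
    in unavoidable-vertex⇒DeterminingPair x≢v y≢v W shortest unavoidable

  DeterminingPair-sym : DeterminingPair G a b v → DeterminingPair G b a v
  DeterminingPair-sym (a≢b , ab , av , bv , unique) =
    a≢b ∘ sym , trans (Graph.sym G _ _) ab , bv , av , λ w bw aw → unique w aw bw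

  DeterminingPair-functional : DeterminingPair G a b u → DeterminingPair G a b v → u ≡ v
  DeterminingPair-functional (_ , _ , au , bu , _) (_ , _ , _ , _ , unique) = unique _ au bu

  module Orientation (pairFor : ∀ v → ∃[ a ] ∃[ b ] DeterminingPair G a b v) where

    orient : Fin n ⊎ Fin n → Fin n × Fin n
    orient (inj₁ v) = proj₁ (pairFor v) , proj₁ (proj₂ (pairFor v))
    orient (inj₂ v) = swap (orient (inj₁ v))

    orient-determining : ∀ t → DeterminingPair G (proj₁ (orient t)) (proj₂ (orient t)) (reduce t)
    orient-determining (inj₁ v) = proj₂ (proj₂ (pairFor v))
    orient-determining (inj₂ v) = DeterminingPair-sym (orient-determining (inj₁ v))

    orient-off-diagonal : ∀ t → proj₁ (orient t) ≢ proj₂ (orient t)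
    orient-off-diagonal t = proj₁ (orient-determining t)

    -- Equal images determine the same vertex; its two orientations differ as a ≢ b.
    orient-injective : Injective _≡_ _≡_ orient
    orient-injective {s} {t} eq
      with DeterminingPair-functional
             (subst (λ p → DeterminingPair G (proj₁ p) (proj₂ p) (reduce s)) eq (orient-determining s))
             (orient-determining t)
    orient-injective {inj₁ _} {inj₁ _} _  | refl = refl
    orient-injective {inj₂ _} {inj₂ _} _  | refl = refl
    orient-injective {inj₁ v} {inj₂ _} eq | refl = ⊥-elim (orient-off-diagonal (inj₁ v) (cong proj₁ eq))
    orient-injective {inj₂ v} {inj₁ _} eq | refl = ⊥-elim (orient-off-diagonal (inj₂ v) (cong proj₁ eq))

index : ∀ {S : Subset n} {u} → u ∈ S → Fin ∣ S ∣
index here = zero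
index {S = true ∷ _}  (there u∈S) = suc (index u∈S)
index {S = false ∷ _} (there u∈S) = index u∈S

index-injective : ∀ {S : Subset n} {u v} (u∈S : u ∈ S) (v∈S : v ∈ S) →
  index u∈S ≡ index v∈S → u ≡ v
index-injective here here _ = refl
index-injective {S = true ∷ _} here (there _) ()
index-injective {S = true ∷ _} (there _) here ()
index-injective {S = true ∷ _}  (there u∈S) (there v∈S) eq =
  cong suc (index-injective u∈S v∈S (suc-injective eq))
index-injective {S = false ∷ _} (there u∈S) (there v∈S) eq =
  cong suc (index-injective u∈S v∈S eq)

injective-missing⇒< : {f : Fin m → Fin k} → Injective _≡_ _≡_ f →
  (p : Fin k) → (∀ x → f x ≢ p) → m < k
injective-missing⇒< {k = suc _} {f = f} f-injective p missing =
  s≤s (injective⇒≤ {f = λ x → punchOut (missing x ∘ sym)}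
        (f-injective ∘ punchOut-injective {i = p} _ _))

offDiagonal-injection⇒< : (f : Fin m ⊎ Fin m → Fin k × Fin k) → Injective _≡_ _≡_ f →
  (∀ t → proj₁ (f t) ≢ proj₂ (f t)) → Fin k → 2 * m < k * k
offDiagonal-injection⇒< {m} {k} f f-injective off-diagonal c =
  subst (_< k * k) (cong (m +_) (sym (+-identityʳ m)))
    (injective-missing⇒< g-injective (Inverse.from *↔× (c , c)) g-misses-diagonal)
  where
  g : Fin (m + m) → Fin (k * k)
  g = Inverse.from *↔× ∘ f ∘ Inverse.to +↔⊎

  g-injective : Injective _≡_ _≡_ g
  g-injective = Injection.injective (↔⇒↣ +↔⊎) ∘ f-injective ∘ Injection.injective (↔⇒↣ (↔-sym *↔×))

  g-misses-diagonal : ∀ x → g x ≢ Inverse.from *↔× (c , c)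
  g-misses-diagonal x eq =
    let e₁ , e₂ = ×-≡,≡←≡ (Injection.injective (↔⇒↣ (↔-sym *↔×)) eq)
    in off-diagonal (Inverse.to +↔⊎ x) (trans e₁ (sym e₂))

lemma3p6 : (n : ℕ) → 1 ≤ n → (G : Graph n) → DistanceCritical G →
    (S : Subset n) → (∀ u → (u ∈ S) ⇔ InS G u) →
    2 * n < ∣ S ∣ * ∣ S ∣
lemma3p6 (suc n) _ G critical S S⇔InS =
  offDiagonal-injection⇒< f f-injective f-off-diagonal (proj₁ (f (inj₁ zero)))
  where
  open Orientation G (DistanceCritical⇒DeterminingPair G critical)

  inS : ∀ {u} → InS G u → u ∈ S
  inS = Equivalence.from (S⇔InS _)

  first∈S : ∀ t → proj₁ (orient t) ∈ S
  first∈S t = inS (_ , _ , orient-determining t)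

  second∈S : ∀ t → proj₂ (orient t) ∈ S
  second∈S t = inS (_ , _ , DeterminingPair-sym G (orient-determining t))

  f : Fin (suc n) ⊎ Fin (suc n) → Fin ∣ S ∣ × Fin ∣ S ∣
  f t = index (first∈S t) , index (second∈S t)

  f-injective : Injective _≡_ _≡_ f
  f-injective {s} {t} eq =
    let e₁ , e₂ = ×-≡,≡←≡ eq
    in orient-injective (cong₂ _,_ (index-injective (first∈S s) (first∈S t) e₁)
                                   (index-injective (second∈S s) (second∈S t) e₂))

  f-off-diagonal : ∀ t → proj₁ (f t) ≢ proj₂ (f t)
  f-off-diagonal t = orient-off-diagonal t ∘ index-injective (first∈S t) (second∈S t)
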